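{- Let $m\geq 15$ and $k\geq1$ be integers and let $c(x)=1+\sum_{j\in\{1,2,3,7\}}(x^j+x^{m-j})\in\mathbb{F}_2[x]$. Then $\gcd(c(x^k),x^m-1)=1$ in $\mathbb{F}_2[x]$ if and only if $\gcd(m,3k)=\gcd(m,5k)=\gcd(m,7k)=\gcd(m,k)$.
   Context: In the paper's terminology this says $\{1,2,3,7\}$ is a QBF-set with respect to $(n,k)$, $n=em$: a set $\mathcal{C}\subseteq\{1,\dots,\lfloor\frac{m-1}{2}\rfloor\}$ is a QBF-set if $c(x)=1+\sum_{j\in\mathcal{C}}(x^j+x^{m-j})$ satisfies $\gcd(c(x^k),x^m-1)=1$ over $\mathbb{F}_2$. -}

module Defs where

open import Data.Bool using (Bool; true; false; _xor_; _∧_)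
open import Data.List using (List; []; _∷_; replicate; foldr; map)
open import Data.Nat using (ℕ; zero; suc; _*_; _∸_)
open import Data.Product using (∃)
open import Relation.Binary.PropositionalEquality using (_≡_)

-- Polynomials over F₂ = Bool (true = 1, xor = +, ∧ = ·), as coefficient
-- lists, lowest degree first. Trailing zeros allowed; equality is
-- coefficientwise (_≈ₚ_).
Poly : Set
Poly = List Bool

coeff : Poly → ℕ → Bool
coeff []       _       = false
coeff (a ∷ p)  zero    = a
coeff (a ∷ p)  (suc i) = coeff p i

_≈ₚ_ : Poly → Poly → Set
p ≈ₚ q = ∀ i → coeff p i ≡ coeff q i

infixl 6 _+ₚ_
infixl 7 _*ₚ_ _·ₚ_

_+ₚ_ : Poly → Poly → Poly
[]      +ₚ q       = q
(a ∷ p) +ₚ []      = a ∷ p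
(a ∷ p) +ₚ (b ∷ q) = (a xor b) ∷ (p +ₚ q)

_·ₚ_ : Bool → Poly → Poly
a ·ₚ p = map (a ∧_) p

_*ₚ_ : Poly → Poly → Poly
[]      *ₚ q = []
(a ∷ p) *ₚ q = (a ·ₚ q) +ₚ (false ∷ (p *ₚ q))

oneₚ : Poly
oneₚ = true ∷ []

X^ : ℕ → Poly
X^ n = foldr _∷_ (true ∷ []) (replicate n false)

_∣ₚ_ : Poly → Poly → Set
d ∣ₚ p = ∃ λ r → (d *ₚ r) ≈ₚ p

GcdOne : Poly → Poly → Set
GcdOne p q = ∀ d → d ∣ₚ p → d ∣ₚ q → d ∣ₚ oneₚ

-- x^m - 1 (= x^m + 1 over F₂)
X^m-1 : ℕ → Poly
X^m-1 m = X^ m +ₚ oneₚ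

cPoly : ℕ → ℕ → Poly
cPoly m k = oneₚ
  +ₚ (X^ (1 * k) +ₚ X^ ((m ∸ 1) * k))
  +ₚ (X^ (2 * k) +ₚ X^ ((m ∸ 2) * k))
  +ₚ (X^ (3 * k) +ₚ X^ ((m ∸ 3) * k))
  +ₚ (X^ (7 * k) +ₚ X^ ((m ∸ 7) * k))

-- Write Φ_r = 1 + x + ⋯ + x^(r-1) over F₂, so that (y + 1) Φ_r(y) = y^r + 1, and Φ_r(y) ≡ 1 mod y + 1 for
-- odd r. Modulo x^(mk) + 1, x^(7k) c(x^k) equals (Φ₃² Φ₅ Φ₇)(x^k). If d divides c(x^k) and x^m + 1 and
-- gcd(m, rk) = gcd(m, k), then d ∣ Φ_r(x^k) B gives d ∣ (x^(rk) + 1) B, hence by Euclid on the exponents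
-- d ∣ (x^gcd(m,k) + 1) B ∣ (x^k + 1) B, hence d ∣ B; peeling off the four factors leaves d ∣ 1.
-- Conversely, if gcd(m, rk) ≠ gcd(m, k) for a prime r ∈ {3, 5, 7}, then g = gcd(m, k) satisfies r g ∣ m and
-- r g ∤ k; modulo x^(rg) + 1 the polynomial c(x^k) reduces to 0 or Φ_r(x^g) (a finite check on residues
-- mod r), so the non-unit Φ_r(x^g) divides both c(x^k) and x^m + 1.
module Submission where

open import Defs
open import Algebra.Bundles using (CommutativeRing; CommutativeSemigroup)
import Algebra.Properties.CommutativeSemigroup as CommutativeSemigroupProperties
open import Data.Bool using (true; false; _xor_; _∧_)
open import Data.Bool.Properties
  using (xor-identityʳ; xor-comm; xor-assoc; xor-same; ∧-distribˡ-xor; ∧-distribʳ-xor; ∧-assoc; ∧-comm; ∧-zeroʳ;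
         xor-∧-commutativeRing)
open import Data.Empty using (⊥-elim)
open import Data.List using (List; []; _∷_; _++_; map; replicate; upTo; cartesianProductWith; foldr; length)
open import Data.List.Properties using (map-upTo; upTo-∷ʳ; length-upTo; length-replicate)
open import Data.List.Relation.Binary.Pointwise using (Pointwise; []; _∷_)
open import Data.List.Relation.Unary.All using (All; []; _∷_)
open import Data.List.Relation.Unary.All.Properties using (applyUpTo⁺₁)
open import Data.Nat
  using (ℕ; zero; suc; _+_; _*_; _∸_; _<_; _≤_; _%_; _/_; NonZero; >-nonZero; ≢-nonZero; ≢-nonZero⁻¹; s≤s; z<s; s<s)
import Data.Nat.Properties as ℕ
import Data.Nat.Divisibility as ℕ∣
open ℕ∣ using (m%n≡0⇒n∣m) renaming (_∣_ to _∣ℕ_; divides to dividesℕ)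
open import Data.Nat.DivMod
  using (m≡m%n+[m/n]*n; n%1≡0; [m+n]%n≡m%n; %-remove-+ʳ; %-distribˡ-*; m%n%n≡m%n; m%n<n)
open import Data.Nat.GCD
  using (gcd; gcd-GCD; gcd[m,n]∣m; gcd[m,n]∣n; gcd-greatest; c*gcd[m,n]≡gcd[cm,cn]; gcd[m,n]≢0; module Bézout)
open import Data.Nat.Primality using (Prime; prime?; prime⇒irreducible; ¬prime[1])
open import Data.Product using (_×_; _,_; ∃; proj₁; proj₂)
open import Data.Sum using (_⊎_; inj₁; inj₂)
open import Function.Base using (_on_; id)
open import Function.Bundles using (_⇔_; mk⇔)
open import Level using (0ℓ)
open import Relation.Binary.Bundles using (Setoid)
open import Relation.Binary.Definitions using (tri<; tri≈; tri>)
open import Relation.Binary.PropositionalEquality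
import Relation.Binary.Reasoning.Setoid as SetoidReasoning
open import Relation.Nullary using (¬_; yes; no)
open import Relation.Nullary.Decidable using (from-yes)

-- The ring F₂[x] up to coefficientwise equality

-- A record around _≈ₚ_ lets Agda infer both polynomials from a proof of their equality.
infix 4 _≋_
record _≋_ (p q : Poly) : Set where
  constructor mk≋
  field coeff-≡ : p ≈ₚ q
open _≋_

≋-setoid : Setoid 0ℓ 0ℓ
≋-setoid = record
  { Carrier       = Poly
  ; _≈_           = _≋_
  ; isEquivalence = record
    { refl  = mk≋ λ _ → refl
    ; sym   = λ e → mk≋ λ i → sym (coeff-≡ e i)
    ; trans = λ e f → mk≋ λ i → trans (coeff-≡ e i) (coeff-≡ f i)
    }
  }

open Setoid ≋-setoid using () renaming (refl to ≋-refl; sym to ≋-sym; trans to ≋-trans; reflexive to ≡⇒≋)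
module ≋-Reasoning = SetoidReasoning ≋-setoid

coeff-+ : ∀ p q i → coeff (p +ₚ q) i ≡ coeff p i xor coeff q i
coeff-+ []      q       i       = refl
coeff-+ (a ∷ p) []      i       = sym (xor-identityʳ _)
coeff-+ (a ∷ p) (b ∷ q) zero    = refl
coeff-+ (a ∷ p) (b ∷ q) (suc i) = coeff-+ p q i

coeff-· : ∀ a p i → coeff (a ·ₚ p) i ≡ a ∧ coeff p i
coeff-· a []      i       = sym (∧-zeroʳ a)
coeff-· a (b ∷ p) zero    = refl
coeff-· a (b ∷ p) (suc i) = coeff-· a p i

∷-cong : ∀ a {p q} → p ≋ q → a ∷ p ≋ a ∷ q
∷-cong a e = mk≋ λ { zero → refl ; (suc i) → coeff-≡ e i }

∷-injectiveʳ : ∀ {a b p q} → a ∷ p ≋ b ∷ q → p ≋ q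
∷-injectiveʳ e = mk≋ λ i → coeff-≡ e (suc i)

false∷[]≋[] : false ∷ [] ≋ []
false∷[]≋[] = mk≋ λ { zero → refl ; (suc i) → refl }

∷-zero : ∀ {a p} → a ∷ p ≋ [] → p ≋ []
∷-zero e = mk≋ λ i → coeff-≡ e (suc i)

+-cong : ∀ {p p′ q q′} → p ≋ p′ → q ≋ q′ → p +ₚ q ≋ p′ +ₚ q′
+-cong {p} {p′} {q} {q′} e f = mk≋ λ i → begin
  coeff (p +ₚ q) i          ≡⟨ coeff-+ p q i ⟩
  coeff p i xor coeff q i   ≡⟨ cong₂ _xor_ (coeff-≡ e i) (coeff-≡ f i) ⟩
  coeff p′ i xor coeff q′ i ≡⟨ coeff-+ p′ q′ i ⟨
  coeff (p′ +ₚ q′) i        ∎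
  where open ≡-Reasoning

+-congʳ : ∀ {p p′} q → p ≋ p′ → p +ₚ q ≋ p′ +ₚ q
+-congʳ q e = +-cong e ≋-refl

+-congˡ : ∀ p {q q′} → q ≋ q′ → p +ₚ q ≋ p +ₚ q′
+-congˡ p e = +-cong ≋-refl e

+-comm : ∀ p q → p +ₚ q ≋ q +ₚ p
+-comm p q = mk≋ λ i → begin
  coeff (p +ₚ q) i        ≡⟨ coeff-+ p q i ⟩
  coeff p i xor coeff q i ≡⟨ xor-comm (coeff p i) _ ⟩
  coeff q i xor coeff p i ≡⟨ coeff-+ q p i ⟨
  coeff (q +ₚ p) i        ∎
  where open ≡-Reasoning

+-assoc : ∀ p q r → (p +ₚ q) +ₚ r ≋ p +ₚ (q +ₚ r)
+-assoc p q r = mk≋ λ i → begin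
  coeff ((p +ₚ q) +ₚ r) i                   ≡⟨ coeff-+ (p +ₚ q) r i ⟩
  coeff (p +ₚ q) i xor coeff r i            ≡⟨ cong (_xor coeff r i) (coeff-+ p q i) ⟩
  (coeff p i xor coeff q i) xor coeff r i   ≡⟨ xor-assoc (coeff p i) _ _ ⟩
  coeff p i xor (coeff q i xor coeff r i)   ≡⟨ cong (coeff p i xor_) (coeff-+ q r i) ⟨
  coeff p i xor coeff (q +ₚ r) i            ≡⟨ coeff-+ p (q +ₚ r) i ⟨
  coeff (p +ₚ (q +ₚ r)) i                   ∎
  where open ≡-Reasoning

+-identityʳ : ∀ p → p +ₚ [] ≋ p
+-identityʳ p = mk≋ λ i → trans (coeff-+ p [] i) (xor-identityʳ (coeff p i))

+-same : ∀ p → p +ₚ p ≋ []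
+-same p = mk≋ λ i → trans (coeff-+ p p i) (xor-same (coeff p i))

+-cancelʳ : ∀ p q → (p +ₚ q) +ₚ q ≋ p
+-cancelʳ p q = begin
  (p +ₚ q) +ₚ q ≈⟨ +-assoc p q q ⟩
  p +ₚ (q +ₚ q) ≈⟨ +-congˡ p (+-same q) ⟩
  p +ₚ []       ≈⟨ +-identityʳ p ⟩
  p             ∎
  where open ≋-Reasoning

+-same-cancelˡ : ∀ p q → p +ₚ (p +ₚ q) ≋ q
+-same-cancelˡ p q = ≋-trans (≋-sym (+-assoc p p q)) (+-congʳ q (+-same p))

+-commutativeSemigroup : CommutativeSemigroup 0ℓ 0ℓ
+-commutativeSemigroup = record
  { _≈_                     = _≋_
  ; _∙_                     = _+ₚ_
  ; isCommutativeSemigroup  = record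
    { isSemigroup = record
      { isMagma = record { isEquivalence = Setoid.isEquivalence ≋-setoid ; ∙-cong = +-cong }
      ; assoc   = +-assoc
      }
    ; comm        = +-comm
    }
  }

open CommutativeSemigroupProperties +-commutativeSemigroup
  using () renaming (interchange to +-interchange; x∙yz≈y∙xz to +-swapˡ)

+-cancel-common : ∀ p q r → (p +ₚ r) +ₚ (q +ₚ r) ≋ p +ₚ q
+-cancel-common p q r = begin
  (p +ₚ r) +ₚ (q +ₚ r) ≈⟨ +-interchange p r q r ⟩
  (p +ₚ q) +ₚ (r +ₚ r) ≈⟨ +-congˡ (p +ₚ q) (+-same r) ⟩
  (p +ₚ q) +ₚ []       ≈⟨ +-identityʳ (p +ₚ q) ⟩
  p +ₚ q               ∎
  where open ≋-Reasoning

·-cong : ∀ a {p q} → p ≋ q → a ·ₚ p ≋ a ·ₚ q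
·-cong a {p} {q} e = mk≋ λ i → begin
  coeff (a ·ₚ p) i ≡⟨ coeff-· a p i ⟩
  a ∧ coeff p i    ≡⟨ cong (a ∧_) (coeff-≡ e i) ⟩
  a ∧ coeff q i    ≡⟨ coeff-· a q i ⟨
  coeff (a ·ₚ q) i ∎
  where open ≡-Reasoning

·-distribˡ : ∀ a p q → a ·ₚ (p +ₚ q) ≋ a ·ₚ p +ₚ a ·ₚ q
·-distribˡ a p q = mk≋ λ i → begin
  coeff (a ·ₚ (p +ₚ q)) i                          ≡⟨ coeff-· a (p +ₚ q) i ⟩
  a ∧ coeff (p +ₚ q) i                             ≡⟨ cong (a ∧_) (coeff-+ p q i) ⟩
  a ∧ (coeff p i xor coeff q i)                    ≡⟨ ∧-distribˡ-xor a _ _ ⟩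
  (a ∧ coeff p i) xor (a ∧ coeff q i)              ≡⟨ cong₂ _xor_ (coeff-· a p i) (coeff-· a q i) ⟨
  coeff (a ·ₚ p) i xor coeff (a ·ₚ q) i            ≡⟨ coeff-+ (a ·ₚ p) (a ·ₚ q) i ⟨
  coeff (a ·ₚ p +ₚ a ·ₚ q) i                       ∎
  where open ≡-Reasoning

·-distribʳ : ∀ a b p → (a xor b) ·ₚ p ≋ a ·ₚ p +ₚ b ·ₚ p
·-distribʳ a b p = mk≋ λ i → begin
  coeff ((a xor b) ·ₚ p) i                ≡⟨ coeff-· (a xor b) p i ⟩
  (a xor b) ∧ coeff p i                   ≡⟨ ∧-distribʳ-xor (coeff p i) a b ⟩
  (a ∧ coeff p i) xor (b ∧ coeff p i)     ≡⟨ cong₂ _xor_ (coeff-· a p i) (coeff-· b p i) ⟨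
  coeff (a ·ₚ p) i xor coeff (b ·ₚ p) i   ≡⟨ coeff-+ (a ·ₚ p) (b ·ₚ p) i ⟨
  coeff (a ·ₚ p +ₚ b ·ₚ p) i              ∎
  where open ≡-Reasoning

·-assoc : ∀ a b p → (a ∧ b) ·ₚ p ≋ a ·ₚ (b ·ₚ p)
·-assoc a b p = mk≋ λ i → begin
  coeff ((a ∧ b) ·ₚ p) i ≡⟨ coeff-· (a ∧ b) p i ⟩
  (a ∧ b) ∧ coeff p i    ≡⟨ ∧-assoc a b _ ⟩
  a ∧ (b ∧ coeff p i)    ≡⟨ cong (a ∧_) (coeff-· b p i) ⟨
  a ∧ coeff (b ·ₚ p) i   ≡⟨ coeff-· a (b ·ₚ p) i ⟨
  coeff (a ·ₚ (b ·ₚ p)) i ∎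
  where open ≡-Reasoning

false-· : ∀ p → false ·ₚ p ≋ []
false-· p = mk≋ (coeff-· false p)

true-· : ∀ p → true ·ₚ p ≋ p
true-· p = mk≋ (coeff-· true p)

·-∷-false : ∀ a p → a ·ₚ (false ∷ p) ≋ false ∷ (a ·ₚ p)
·-∷-false a p = mk≋ λ { zero → ∧-zeroʳ a ; (suc i) → refl }

*-congˡ : ∀ p {q q′} → q ≋ q′ → p *ₚ q ≋ p *ₚ q′
*-congˡ []      e = ≋-refl
*-congˡ (a ∷ p) e = +-cong (·-cong a e) (∷-cong false (*-congˡ p e))

*-zeroˡ : ∀ {p} q → p ≋ [] → p *ₚ q ≋ []
*-zeroˡ {[]}    q e = ≋-refl
*-zeroˡ {a ∷ p} q e with coeff-≡ e zero
... | refl = begin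
  false ·ₚ q +ₚ (false ∷ p *ₚ q) ≈⟨ +-cong (false-· q) (∷-cong false (*-zeroˡ q (∷-zero e))) ⟩
  [] +ₚ (false ∷ [])             ≈⟨ false∷[]≋[] ⟩
  []                             ∎
  where open ≋-Reasoning

*-congʳ : ∀ {p p′} q → p ≋ p′ → p *ₚ q ≋ p′ *ₚ q
*-congʳ {[]}    {[]}     q e = ≋-refl
*-congʳ {[]}    {a ∷ p′} q e = ≋-sym (*-zeroˡ q (≋-sym e))
*-congʳ {a ∷ p} {[]}     q e = *-zeroˡ q e
*-congʳ {a ∷ p} {b ∷ p′} q e with coeff-≡ e zero
... | refl = +-congˡ (a ·ₚ q) (∷-cong false (*-congʳ q (∷-injectiveʳ e)))

false∷-* : ∀ p q → (false ∷ p) *ₚ q ≋ false ∷ (p *ₚ q)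
false∷-* p q = +-congʳ (false ∷ p *ₚ q) (false-· q)

*-distribʳ : ∀ p p′ q → (p +ₚ p′) *ₚ q ≋ p *ₚ q +ₚ p′ *ₚ q
*-distribʳ []      p′       q = ≋-refl
*-distribʳ (a ∷ p) []       q = ≋-sym (+-identityʳ _)
*-distribʳ (a ∷ p) (b ∷ p′) q = begin
  (a xor b) ·ₚ q +ₚ (false ∷ (p +ₚ p′) *ₚ q)
    ≈⟨ +-cong (·-distribʳ a b q) (∷-cong false (*-distribʳ p p′ q)) ⟩
  (a ·ₚ q +ₚ b ·ₚ q) +ₚ ((false ∷ p *ₚ q) +ₚ (false ∷ p′ *ₚ q))
    ≈⟨ +-interchange (a ·ₚ q) (b ·ₚ q) (false ∷ p *ₚ q) (false ∷ p′ *ₚ q) ⟩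
  (a ·ₚ q +ₚ (false ∷ p *ₚ q)) +ₚ (b ·ₚ q +ₚ (false ∷ p′ *ₚ q))
    ∎
  where open ≋-Reasoning

·-* : ∀ a q r → (a ·ₚ q) *ₚ r ≋ a ·ₚ (q *ₚ r)
·-* a []      r = ≋-refl
·-* a (b ∷ q) r = begin
  (a ∧ b) ·ₚ r +ₚ (false ∷ (a ·ₚ q) *ₚ r)    ≈⟨ +-cong (·-assoc a b r) (∷-cong false (·-* a q r)) ⟩
  a ·ₚ (b ·ₚ r) +ₚ (false ∷ a ·ₚ (q *ₚ r))   ≈⟨ +-congˡ (a ·ₚ (b ·ₚ r)) (·-∷-false a (q *ₚ r)) ⟨
  a ·ₚ (b ·ₚ r) +ₚ a ·ₚ (false ∷ q *ₚ r)     ≈⟨ ·-distribˡ a (b ·ₚ r) (false ∷ q *ₚ r) ⟨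
  a ·ₚ (b ·ₚ r +ₚ (false ∷ q *ₚ r))          ∎
  where open ≋-Reasoning

*-assoc : ∀ p q r → (p *ₚ q) *ₚ r ≋ p *ₚ (q *ₚ r)
*-assoc []      q r = ≋-refl
*-assoc (a ∷ p) q r = begin
  (a ·ₚ q +ₚ (false ∷ p *ₚ q)) *ₚ r           ≈⟨ *-distribʳ (a ·ₚ q) (false ∷ p *ₚ q) r ⟩
  (a ·ₚ q) *ₚ r +ₚ (false ∷ p *ₚ q) *ₚ r      ≈⟨ +-cong (·-* a q r) (false∷-* (p *ₚ q) r) ⟩
  a ·ₚ (q *ₚ r) +ₚ (false ∷ (p *ₚ q) *ₚ r)    ≈⟨ +-congˡ (a ·ₚ (q *ₚ r)) (∷-cong false (*-assoc p q r)) ⟩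
  a ·ₚ (q *ₚ r) +ₚ (false ∷ p *ₚ (q *ₚ r))    ∎
  where open ≋-Reasoning

*-zeroʳ : ∀ p → p *ₚ [] ≋ []
*-zeroʳ []      = ≋-refl
*-zeroʳ (a ∷ p) = mk≋ λ { zero → refl ; (suc i) → coeff-≡ (*-zeroʳ p) i }

*-∷ : ∀ p b q → p *ₚ (b ∷ q) ≋ b ·ₚ p +ₚ (false ∷ p *ₚ q)
*-∷ []      b q = mk≋ λ { zero → refl ; (suc i) → refl }
*-∷ (a ∷ p) b q = mk≋ λ
  { zero    → cong (_xor false) (∧-comm a b)
  ; (suc i) → begin
      coeff (a ·ₚ q +ₚ p *ₚ (b ∷ q)) i                    ≡⟨ coeff-+ (a ·ₚ q) _ i ⟩
      coeff (a ·ₚ q) i xor coeff (p *ₚ (b ∷ q)) i         ≡⟨ cong (coeff (a ·ₚ q) i xor_) (coeff-≡ (*-∷ p b q) i) ⟩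
      coeff (a ·ₚ q) i xor coeff (b ·ₚ p +ₚ P) i          ≡⟨ cong (coeff (a ·ₚ q) i xor_) (coeff-+ (b ·ₚ p) P i) ⟩
      coeff (a ·ₚ q) i xor (coeff (b ·ₚ p) i xor coeff P i)
        ≡⟨ x∙yz≈y∙xz (coeff (a ·ₚ q) i) (coeff (b ·ₚ p) i) (coeff P i) ⟩
      coeff (b ·ₚ p) i xor (coeff (a ·ₚ q) i xor coeff P i) ≡⟨ cong (coeff (b ·ₚ p) i xor_) (coeff-+ (a ·ₚ q) P i) ⟨
      coeff (b ·ₚ p) i xor coeff (a ·ₚ q +ₚ P) i          ≡⟨ coeff-+ (b ·ₚ p) _ i ⟨
      coeff (b ·ₚ p +ₚ (a ·ₚ q +ₚ P)) i                   ∎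
  }
  where
  open ≡-Reasoning
  open CommutativeSemigroupProperties (CommutativeRing.+-commutativeSemigroup xor-∧-commutativeRing) using (x∙yz≈y∙xz)
  P = false ∷ p *ₚ q

*-comm : ∀ p q → p *ₚ q ≋ q *ₚ p
*-comm []      q = ≋-sym (*-zeroʳ q)
*-comm (a ∷ p) q = ≋-trans (+-congˡ (a ·ₚ q) (∷-cong false (*-comm p q))) (≋-sym (*-∷ q a p))

*-distribˡ : ∀ p q r → p *ₚ (q +ₚ r) ≋ p *ₚ q +ₚ p *ₚ r
*-distribˡ p q r = begin
  p *ₚ (q +ₚ r)       ≈⟨ *-comm p (q +ₚ r) ⟩
  (q +ₚ r) *ₚ p       ≈⟨ *-distribʳ q r p ⟩
  q *ₚ p +ₚ r *ₚ p    ≈⟨ +-cong (*-comm q p) (*-comm r p) ⟩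
  p *ₚ q +ₚ p *ₚ r    ∎
  where open ≋-Reasoning

*-identityˡ : ∀ p → oneₚ *ₚ p ≋ p
*-identityˡ p = begin
  true ·ₚ p +ₚ (false ∷ []) ≈⟨ +-cong (true-· p) false∷[]≋[] ⟩
  p +ₚ []                   ≈⟨ +-identityʳ p ⟩
  p                         ∎
  where open ≋-Reasoning

*-identityʳ : ∀ p → p *ₚ oneₚ ≋ p
*-identityʳ p = ≋-trans (*-comm p oneₚ) (*-identityˡ p)

X^-+ : ∀ a b → X^ a *ₚ X^ b ≋ X^ (a + b)
X^-+ zero    b = *-identityˡ (X^ b)
X^-+ (suc a) b = ≋-trans (false∷-* (X^ a) (X^ b)) (∷-cong false (X^-+ a b))

-- Divisibility

infix 4 _∣_
record _∣_ (d p : Poly) : Set where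
  constructor divides
  field
    quotient : Poly
    equality : d *ₚ quotient ≋ p

∣-resp-≋ : ∀ {d p q} → d ∣ p → p ≋ q → d ∣ q
∣-resp-≋ (divides r e) f = divides r (≋-trans e f)

∣-refl : ∀ {d} → d ∣ d
∣-refl {d} = divides oneₚ (*-identityʳ d)

∣p⇒∣p*q : ∀ {d p} q → d ∣ p → d ∣ p *ₚ q
∣p⇒∣p*q {d} q (divides r e) = divides (r *ₚ q) (≋-trans (≋-sym (*-assoc d r q)) (*-congʳ q e))

∣q⇒∣p*q : ∀ {d q} p → d ∣ q → d ∣ p *ₚ q
∣q⇒∣p*q {q = q} p h = ∣-resp-≋ (∣p⇒∣p*q p h) (*-comm q p)

∣-trans : ∀ {d e p} → d ∣ e → e ∣ p → d ∣ p
∣-trans h (divides s f) = ∣-resp-≋ (∣p⇒∣p*q s h) f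

*-monoˡ-∣ : ∀ {d p} q → d ∣ p → d *ₚ q ∣ p *ₚ q
*-monoˡ-∣ {d} {p} q (divides r e) = divides r (begin
  (d *ₚ q) *ₚ r ≈⟨ *-assoc d q r ⟩
  d *ₚ (q *ₚ r) ≈⟨ *-congˡ d (*-comm q r) ⟩
  d *ₚ (r *ₚ q) ≈⟨ *-assoc d r q ⟨
  (d *ₚ r) *ₚ q ≈⟨ *-congʳ q e ⟩
  p *ₚ q        ∎)
  where open ≋-Reasoning

∣-zero : ∀ {d p} → p ≋ [] → d ∣ p
∣-zero {d} e = divides [] (≋-trans (*-zeroʳ d) (≋-sym e))

∣-+ : ∀ {d p q} → d ∣ p → d ∣ q → d ∣ p +ₚ q
∣-+ {d} (divides r e) (divides s f) = divides (r +ₚ s) (≋-trans (*-distribˡ d r s) (+-cong e f))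

∣-cancelʳ : ∀ {d p q} → d ∣ p +ₚ q → d ∣ q → d ∣ p
∣-cancelʳ {p = p} {q} h k = ∣-resp-≋ (∣-+ h k) (+-cancelʳ p q)

∣-cancelˡ : ∀ {d p q} → d ∣ p +ₚ q → d ∣ p → d ∣ q
∣-cancelˡ {p = p} {q} h k = ∣-cancelʳ (∣-resp-≋ h (+-comm p q)) k

∣ₚ⇒∣ : ∀ {d p} → d ∣ₚ p → d ∣ p
∣ₚ⇒∣ (r , e) = divides r (mk≋ e)

∣⇒∣ₚ : ∀ {d p} → d ∣ p → d ∣ₚ p
∣⇒∣ₚ (divides r e) = r , coeff-≡ e

-- Sparse polynomials Σ_{e ∈ es} x^(e g)

sparse : ℕ → List ℕ → Poly
sparse g []       = []
sparse g (e ∷ es) = X^ (e * g) +ₚ sparse g es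

Φ : ℕ → ℕ → Poly
Φ r g = sparse g (upTo r)

sparse-++ : ∀ g es fs → sparse g (es ++ fs) ≋ sparse g es +ₚ sparse g fs
sparse-++ g []       fs = ≋-refl
sparse-++ g (e ∷ es) fs = ≋-trans (+-congˡ (X^ (e * g)) (sparse-++ g es fs)) (≋-sym (+-assoc (X^ (e * g)) _ _))

X^*sparse : ∀ g a fs → X^ (a * g) *ₚ sparse g fs ≋ sparse g (map (a +_) fs)
X^*sparse g a []       = *-zeroʳ (X^ (a * g))
X^*sparse g a (f ∷ fs) = begin
  X^ (a * g) *ₚ (X^ (f * g) +ₚ sparse g fs)                ≈⟨ *-distribˡ (X^ (a * g)) (X^ (f * g)) (sparse g fs) ⟩
  X^ (a * g) *ₚ X^ (f * g) +ₚ X^ (a * g) *ₚ sparse g fs    ≈⟨ +-cong (X^-+ (a * g) (f * g)) (X^*sparse g a fs) ⟩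
  X^ (a * g + f * g) +ₚ sparse g (map (a +_) fs)
    ≡⟨ cong (λ n → X^ n +ₚ sparse g (map (a +_) fs)) (ℕ.*-distribʳ-+ g a f) ⟨
  X^ ((a + f) * g) +ₚ sparse g (map (a +_) fs)             ∎
  where open ≋-Reasoning

infixr 7 _⊛_
_⊛_ : List ℕ → List ℕ → List ℕ
_⊛_ = cartesianProductWith _+_

sparse-⊛ : ∀ g es fs → sparse g es *ₚ sparse g fs ≋ sparse g (es ⊛ fs)
sparse-⊛ g []       fs = ≋-refl
sparse-⊛ g (e ∷ es) fs = begin
  (X^ (e * g) +ₚ sparse g es) *ₚ sparse g fs
    ≈⟨ *-distribʳ (X^ (e * g)) (sparse g es) (sparse g fs) ⟩
  X^ (e * g) *ₚ sparse g fs +ₚ sparse g es *ₚ sparse g fs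
    ≈⟨ +-cong (X^*sparse g e fs) (sparse-⊛ g es fs) ⟩
  sparse g (map (e +_) fs) +ₚ sparse g (es ⊛ fs)
    ≈⟨ sparse-++ g (map (e +_) fs) (es ⊛ fs) ⟨
  sparse g (map (e +_) fs ++ es ⊛ fs)
    ∎
  where open ≋-Reasoning

sparse-scale : ∀ k g es → sparse (k * g) es ≋ sparse g (map (_* k) es)
sparse-scale k g []       = ≋-refl
sparse-scale k g (e ∷ es) = +-cong (≡⇒≋ (cong X^ (sym (ℕ.*-assoc e k g)))) (sparse-scale k g es)

insert : ℕ → List ℕ → List ℕ
insert e []       = e ∷ []
insert e (f ∷ fs) with ℕ.<-cmp e f
... | tri< _ _ _ = e ∷ f ∷ fs
... | tri≈ _ _ _ = fs
... | tri> _ _ _ = f ∷ insert e fs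

-- The exponents occurring an odd number of times, in increasing order: a canonical form for
-- sparse g es that is computed by normalisation, so identities between sparse polynomials hold by refl.
normalise : List ℕ → List ℕ
normalise = foldr insert []

sparse-insert : ∀ g e fs → sparse g (insert e fs) ≋ X^ (e * g) +ₚ sparse g fs
sparse-insert g e []       = ≋-refl
sparse-insert g e (f ∷ fs) with ℕ.<-cmp e f
... | tri< _ _    _ = ≋-refl
... | tri≈ _ refl _ = ≋-sym (+-same-cancelˡ (X^ (e * g)) (sparse g fs))
... | tri> _ _    _ = ≋-trans (+-congˡ (X^ (f * g)) (sparse-insert g e fs)) (+-swapˡ (X^ (f * g)) (X^ (e * g)) (sparse g fs))

sparse-normalise : ∀ g es → sparse g (normalise es) ≋ sparse g es
sparse-normalise g []       = ≋-refl
sparse-normalise g (e ∷ es) = ≋-trans (sparse-insert g e (normalise es)) (+-congˡ (X^ (e * g)) (sparse-normalise g es))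

sparse-≋ : ∀ g es fs → normalise es ≡ normalise fs → sparse g es ≋ sparse g fs
sparse-≋ g es fs eq = begin
  sparse g es             ≈⟨ sparse-normalise g es ⟨
  sparse g (normalise es) ≡⟨ cong (sparse g) eq ⟩
  sparse g (normalise fs) ≈⟨ sparse-normalise g fs ⟩
  sparse g fs             ∎
  where open ≋-Reasoning

-- The binomials x^a + 1

X^*X^m-1 : ∀ a b → X^ a *ₚ X^m-1 b ≋ X^m-1 (a + b) +ₚ X^m-1 a
X^*X^m-1 a b = begin
  X^ a *ₚ (X^ b +ₚ oneₚ)                  ≈⟨ *-distribˡ (X^ a) (X^ b) oneₚ ⟩
  X^ a *ₚ X^ b +ₚ X^ a *ₚ oneₚ            ≈⟨ +-cong (X^-+ a b) (*-identityʳ (X^ a)) ⟩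
  X^ (a + b) +ₚ X^ a                      ≈⟨ +-cancel-common (X^ (a + b)) (X^ a) oneₚ ⟨
  X^m-1 (a + b) +ₚ X^m-1 a                ∎
  where open ≋-Reasoning

X^m-1*Φ : ∀ a t → X^m-1 a *ₚ Φ t a ≋ X^m-1 (t * a)
X^m-1*Φ a zero    = ≋-trans (*-zeroʳ (X^m-1 a)) (≋-sym (+-same oneₚ))
X^m-1*Φ a (suc t) = begin
  X^m-1 a *ₚ Φ (suc t) a
    ≡⟨ cong (λ es → X^m-1 a *ₚ (oneₚ +ₚ sparse a es)) (map-upTo suc t) ⟨
  X^m-1 a *ₚ (oneₚ +ₚ sparse a (map suc (upTo t)))
    ≈⟨ *-distribˡ (X^m-1 a) oneₚ _ ⟩
  X^m-1 a *ₚ oneₚ +ₚ X^m-1 a *ₚ sparse a (map suc (upTo t))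
    ≈⟨ +-cong (*-identityʳ (X^m-1 a)) (*-congˡ (X^m-1 a) (≋-sym (X^*sparse a 1 (upTo t)))) ⟩
  X^m-1 a +ₚ X^m-1 a *ₚ (X^ (1 * a) *ₚ Φ t a)
    ≡⟨ cong (λ n → X^m-1 a +ₚ X^m-1 a *ₚ (X^ n *ₚ Φ t a)) (ℕ.*-identityˡ a) ⟩
  X^m-1 a +ₚ X^m-1 a *ₚ (X^ a *ₚ Φ t a)
    ≈⟨ +-congˡ (X^m-1 a) (shuffle (X^m-1 a) (X^ a) (Φ t a)) ⟩
  X^m-1 a +ₚ X^ a *ₚ (X^m-1 a *ₚ Φ t a)
    ≈⟨ +-congˡ (X^m-1 a) (*-congˡ (X^ a) (X^m-1*Φ a t)) ⟩
  X^m-1 a +ₚ X^ a *ₚ X^m-1 (t * a)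
    ≈⟨ +-congˡ (X^m-1 a) (X^*X^m-1 a (t * a)) ⟩
  X^m-1 a +ₚ (X^m-1 (a + t * a) +ₚ X^m-1 a)
    ≈⟨ +-comm (X^m-1 a) _ ⟩
  (X^m-1 (a + t * a) +ₚ X^m-1 a) +ₚ X^m-1 a
    ≈⟨ +-cancelʳ (X^m-1 (a + t * a)) (X^m-1 a) ⟩
  X^m-1 (suc t * a)
    ∎
  where
  open ≋-Reasoning
  shuffle : ∀ p q r → p *ₚ (q *ₚ r) ≋ q *ₚ (p *ₚ r)
  shuffle p q r = ≋-trans (≋-sym (*-assoc p q r)) (≋-trans (*-congʳ r (*-comm p q)) (*-assoc q p r))

X^m-1-mono-∣ : ∀ {a b} → a ∣ℕ b → X^m-1 a ∣ X^m-1 b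
X^m-1-mono-∣ {a} (dividesℕ t refl) = divides (Φ t a) (X^m-1*Φ a t)

∣X^m-1*-mono : ∀ {d a b} B → a ∣ℕ b → d ∣ X^m-1 a *ₚ B → d ∣ X^m-1 b *ₚ B
∣X^m-1*-mono B a∣b h = ∣-trans h (*-monoˡ-∣ B (X^m-1-mono-∣ a∣b))

∣X^m-1*-cancel : ∀ {d} B g u → d ∣ X^m-1 (g + u) *ₚ B → d ∣ X^m-1 u *ₚ B → d ∣ X^m-1 g *ₚ B
∣X^m-1*-cancel {d} B g u hgu hu = ∣-cancelʳ (∣-resp-≋ (∣q⇒∣p*q (X^ g) hu) expand) hgu
  where
  open ≋-Reasoning
  expand : X^ g *ₚ (X^m-1 u *ₚ B) ≋ X^m-1 g *ₚ B +ₚ X^m-1 (g + u) *ₚ B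
  expand = begin
    X^ g *ₚ (X^m-1 u *ₚ B)                     ≈⟨ *-assoc (X^ g) (X^m-1 u) B ⟨
    (X^ g *ₚ X^m-1 u) *ₚ B                     ≈⟨ *-congʳ B (≋-trans (X^*X^m-1 g u) (+-comm (X^m-1 (g + u)) (X^m-1 g))) ⟩
    (X^m-1 g +ₚ X^m-1 (g + u)) *ₚ B            ≈⟨ *-distribʳ (X^m-1 g) (X^m-1 (g + u)) B ⟩
    X^m-1 g *ₚ B +ₚ X^m-1 (g + u) *ₚ B         ∎

-- Euclid's algorithm on the exponents, run through a Bézout identity for gcd a b.
∣X^m-1*-gcd : ∀ {d} B a b → d ∣ X^m-1 a *ₚ B → d ∣ X^m-1 b *ₚ B → d ∣ X^m-1 (gcd a b) *ₚ B
∣X^m-1*-gcd {d} B a b ha hb with Bézout.identity (gcd-GCD a b)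
... | Bézout.+- x y eq =
  ∣X^m-1*-cancel B (gcd a b) (y * b)
    (subst (λ n → d ∣ X^m-1 n *ₚ B) (sym eq) (∣X^m-1*-mono B (ℕ∣.n∣m*n x) ha))
    (∣X^m-1*-mono B (ℕ∣.n∣m*n y) hb)
... | Bézout.-+ x y eq =
  ∣X^m-1*-cancel B (gcd a b) (x * a)
    (subst (λ n → d ∣ X^m-1 n *ₚ B) (sym eq) (∣X^m-1*-mono B (ℕ∣.n∣m*n y) hb))
    (∣X^m-1*-mono B (ℕ∣.n∣m*n x) ha)

X^m-1∣X^[a+qn]+X^a : ∀ n a q → X^m-1 n ∣ X^ (a + q * n) +ₚ X^ a
X^m-1∣X^[a+qn]+X^a n a q = ∣-resp-≋ (∣q⇒∣p*q (X^ a) (X^m-1-mono-∣ (ℕ∣.n∣m*n q))) (begin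
  X^ a *ₚ X^m-1 (q * n)                  ≈⟨ X^*X^m-1 a (q * n) ⟩
  X^m-1 (a + q * n) +ₚ X^m-1 a           ≈⟨ +-cancel-common (X^ (a + q * n)) (X^ a) oneₚ ⟩
  X^ (a + q * n) +ₚ X^ a                 ∎)
  where open ≋-Reasoning

X^m-1∣X^+X^% : ∀ r .{{_ : NonZero r}} g e → X^m-1 (r * g) ∣ X^ (e * g) +ₚ X^ (e % r * g)
X^m-1∣X^+X^% r g e = subst (λ n → X^m-1 (r * g) ∣ X^ n +ₚ X^ (e % r * g)) exponent
  (X^m-1∣X^[a+qn]+X^a (r * g) (e % r * g) (e / r))
  where
  open ≡-Reasoning
  exponent : e % r * g + e / r * (r * g) ≡ e * g
  exponent = begin
    e % r * g + e / r * (r * g)   ≡⟨ cong (e % r * g +_) (ℕ.*-assoc (e / r) r g) ⟨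
    e % r * g + e / r * r * g     ≡⟨ ℕ.*-distribʳ-+ g (e % r) (e / r * r) ⟨
    (e % r + e / r * r) * g       ≡⟨ cong (_* g) (m≡m%n+[m/n]*n e r) ⟨
    e * g                         ∎

X^m-1∣X^+X^ : ∀ r .{{_ : NonZero r}} g {e f} → e % r ≡ f % r → X^m-1 (r * g) ∣ X^ (e * g) +ₚ X^ (f * g)
X^m-1∣X^+X^ r g {e} {f} e≡f = ∣-resp-≋ (∣-+ (X^m-1∣X^+X^% r g e) (X^m-1∣X^+X^% r g f)) (begin
  (X^ (e * g) +ₚ X^ (e % r * g)) +ₚ (X^ (f * g) +ₚ X^ (f % r * g))
    ≡⟨ cong (λ n → (X^ (e * g) +ₚ X^ (n * g)) +ₚ (X^ (f * g) +ₚ X^ (f % r * g))) e≡f ⟩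
  (X^ (e * g) +ₚ X^ (f % r * g)) +ₚ (X^ (f * g) +ₚ X^ (f % r * g))
    ≈⟨ +-cancel-common (X^ (e * g)) (X^ (f * g)) (X^ (f % r * g)) ⟩
  X^ (e * g) +ₚ X^ (f * g)
    ∎)
  where open ≋-Reasoning

X^m-1∣sparse+sparse : ∀ r .{{_ : NonZero r}} g {es fs} → Pointwise (_≡_ on (_% r)) es fs →
                      X^m-1 (r * g) ∣ sparse g es +ₚ sparse g fs
X^m-1∣sparse+sparse r g []                            = ∣-zero ≋-refl
X^m-1∣sparse+sparse r g {e ∷ es} {f ∷ fs} (e≡f ∷ pw) =
  ∣-resp-≋ (∣-+ (X^m-1∣X^+X^ r g e≡f) (X^m-1∣sparse+sparse r g pw))
           (+-interchange (X^ (e * g)) (X^ (f * g)) (sparse g es) (sparse g fs))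

-- Degrees

record HasDegree (p : Poly) (n : ℕ) : Set where
  field
    leading   : coeff p n ≡ true
    vanishing : ∀ {i} → n < i → coeff p i ≡ false
open HasDegree

HasDegree-resp-≋ : ∀ {p q n} → p ≋ q → HasDegree p n → HasDegree q n
HasDegree-resp-≋ e d = record
  { leading   = trans (sym (coeff-≡ e _)) (leading d)
  ; vanishing = λ {i} n<i → trans (sym (coeff-≡ e i)) (vanishing d n<i)
  }

HasDegree-+ˡ : ∀ {p q n} → (∀ {i} → n ≤ i → coeff p i ≡ false) → HasDegree q n → HasDegree (p +ₚ q) n
HasDegree-+ˡ {p} {q} {n} low d = record
  { leading   = trans (coeff-+ p q n) (cong₂ _xor_ (low ℕ.≤-refl) (leading d))
  ; vanishing = λ {i} n<i → trans (coeff-+ p q i) (cong₂ _xor_ (low (ℕ.<⇒≤ n<i)) (vanishing d n<i))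
  }

HasDegree-X^ : ∀ e → HasDegree (X^ e) e
HasDegree-X^ zero    = record { leading = refl ; vanishing = λ { {suc i} _ → refl } }
HasDegree-X^ (suc e) = record
  { leading   = leading (HasDegree-X^ e)
  ; vanishing = λ { {suc i} (s<s e<i) → vanishing (HasDegree-X^ e) e<i }
  }

HasDegree-* : ∀ {p q a b} → HasDegree p a → HasDegree q b → HasDegree (p *ₚ q) (a + b)
HasDegree-* {[]} dp with leading dp
... | ()
HasDegree-* {c ∷ p} {q} {zero} dp dq with leading dp
... | refl = HasDegree-resp-≋ (≋-sym (begin
  true ·ₚ q +ₚ (false ∷ p *ₚ q) ≈⟨ +-cong (true-· q) (∷-cong false (*-zeroˡ q p≋[])) ⟩
  q +ₚ (false ∷ [])             ≈⟨ +-congˡ q false∷[]≋[] ⟩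
  q +ₚ []                       ≈⟨ +-identityʳ q ⟩
  q                             ∎)) dq
  where
  open ≋-Reasoning
  p≋[] : p ≋ []
  p≋[] = mk≋ λ i → vanishing dp {suc i} z<s
HasDegree-* {c ∷ p} {q} {suc a} {b} dp dq = HasDegree-+ˡ {c ·ₚ q} {false ∷ p *ₚ q} low (record
  { leading   = leading tail
  ; vanishing = λ { {suc i} (s<s a+b<i) → vanishing tail a+b<i }
  })
  where
  tail : HasDegree (p *ₚ q) (a + b)
  tail = HasDegree-* {p} (record { leading = leading dp ; vanishing = λ a<i → vanishing dp (s<s a<i) }) dq
  low : ∀ {i} → suc (a + b) ≤ i → coeff (c ·ₚ q) i ≡ false
  low {i} a+b<i = trans (coeff-· c q i) (trans (cong (c ∧_) (vanishing dq (ℕ.<-≤-trans (s≤s (ℕ.m≤n+m b a)) a+b<i))) (∧-zeroʳ c))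

≋[]⊎HasDegree : ∀ p → p ≋ [] ⊎ ∃ (HasDegree p)
≋[]⊎HasDegree []      = inj₁ ≋-refl
≋[]⊎HasDegree (a ∷ p) with ≋[]⊎HasDegree p
... | inj₂ (n , d) = inj₂ (suc n , record
  { leading   = leading d
  ; vanishing = λ { {suc i} (s<s n<i) → vanishing d n<i }
  })
≋[]⊎HasDegree (true ∷ p)  | inj₁ p≋[] = inj₂ (0 , record
  { leading   = refl
  ; vanishing = λ { {suc i} _ → coeff-≡ p≋[] i }
  })
≋[]⊎HasDegree (false ∷ p) | inj₁ p≋[] = inj₁ (mk≋ λ { zero → refl ; (suc i) → coeff-≡ p≋[] i })

HasDegree-suc⇒¬∣1 : ∀ {p n} → HasDegree p (suc n) → ¬ (p ∣ oneₚ)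
HasDegree-suc⇒¬∣1 {p} {n} dp (divides e pe≋1) with ≋[]⊎HasDegree e
... | inj₁ e≋[] with trans (sym (coeff-≡ pe≋1 0)) (coeff-≡ (≋-trans (*-congˡ p e≋[]) (*-zeroʳ p)) 0)
...   | ()
HasDegree-suc⇒¬∣1 {p} {n} dp (divides e pe≋1) | inj₂ (b , de)
  with trans (sym (leading (HasDegree-* {p} dp de))) (coeff-≡ pe≋1 (suc n + b))
...   | ()

sparse-vanishing : ∀ g .{{_ : NonZero g}} {t es} → All (_< t) es → ∀ {i} → t * g ≤ i → coeff (sparse g es) i ≡ false
sparse-vanishing g []                        tg≤i = refl
sparse-vanishing g {t} {e ∷ es} (e<t ∷ es<t) {i} tg≤i = begin
  coeff (X^ (e * g) +ₚ sparse g es) i                 ≡⟨ coeff-+ (X^ (e * g)) (sparse g es) i ⟩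
  coeff (X^ (e * g)) i xor coeff (sparse g es) i
    ≡⟨ cong₂ _xor_ (vanishing (HasDegree-X^ (e * g)) eg<i) (sparse-vanishing g es<t tg≤i) ⟩
  false                                               ∎
  where
  open ≡-Reasoning
  eg<i : e * g < i
  eg<i = ℕ.<-≤-trans (ℕ.*-monoˡ-< g e<t) tg≤i

HasDegree-Φ : ∀ g .{{_ : NonZero g}} t → HasDegree (Φ (suc t) g) (t * g)
HasDegree-Φ g t = subst (λ es → HasDegree (sparse g es) (t * g)) (upTo-∷ʳ t)
  (HasDegree-resp-≋ (≋-sym (sparse-++ g (upTo t) (t ∷ [])))
    (HasDegree-+ˡ {sparse g (upTo t)} (sparse-vanishing g (applyUpTo⁺₁ id t id))
      (HasDegree-resp-≋ (≋-sym (+-identityʳ (X^ (t * g)))) (HasDegree-X^ (t * g)))))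

Φ-¬∣1 : ∀ g .{{_ : NonZero g}} t → ¬ (Φ (2 + t) g ∣ oneₚ)
Φ-¬∣1 g@(suc _) t = HasDegree-suc⇒¬∣1 (HasDegree-Φ g (suc t))

-- Coprimality from the gcd conditions

sparse-replicate-odd : ∀ g t → sparse g (replicate (suc (t + t)) 0) ≋ oneₚ
sparse-replicate-odd g zero    = +-identityʳ oneₚ
sparse-replicate-odd g (suc t) rewrite ℕ.+-suc t t =
  ≋-trans (+-same-cancelˡ oneₚ (sparse g (replicate (suc (t + t)) 0))) (sparse-replicate-odd g t)

Pointwise-%1 : ∀ {es fs : List ℕ} → length es ≡ length fs → Pointwise (_≡_ on (_% 1)) es fs
Pointwise-%1 {[]}     {[]}     _   = []
Pointwise-%1 {e ∷ es} {f ∷ fs} len = trans (n%1≡0 e) (sym (n%1≡0 f)) ∷ Pointwise-%1 (ℕ.suc-injective len)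

-- Every exponent is ≡ 0 mod 1, so Φ_r(x^g) ≡ r · 1 = 1 modulo x^g + 1 for odd r.
X^m-1∣Φ-odd+1 : ∀ g t → X^m-1 g ∣ Φ (suc (t + t)) g +ₚ oneₚ
X^m-1∣Φ-odd+1 g t = subst (λ n → X^m-1 n ∣ Φ r g +ₚ oneₚ) (ℕ.*-identityˡ g)
  (∣-resp-≋ (X^m-1∣sparse+sparse 1 g {upTo r} {replicate r 0} (Pointwise-%1 (trans (length-upTo r) (sym (length-replicate r)))))
            (+-congˡ (Φ r g) (sparse-replicate-odd g t)))
  where r = suc (t + t)

∣Φ*-cancel : ∀ {d} m k t B → let r = suc (t + t) in
             gcd m (r * k) ≡ gcd m k → d ∣ X^m-1 m → d ∣ Φ r k *ₚ B → d ∣ B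
∣Φ*-cancel {d} m k t B gcd≡ d∣X^m-1 d∣ΦB = ∣-cancelʳ d∣B+ΦB d∣ΦB
  where
  r = suc (t + t)
  d∣[X^rk-1]B : d ∣ X^m-1 (r * k) *ₚ B
  d∣[X^rk-1]B = ∣-resp-≋ (∣q⇒∣p*q (X^m-1 k) d∣ΦB)
    (≋-trans (≋-sym (*-assoc (X^m-1 k) (Φ r k) B)) (*-congʳ B (X^m-1*Φ k r)))
  d∣[X^gcd-1]B : d ∣ X^m-1 (gcd m k) *ₚ B
  d∣[X^gcd-1]B = subst (λ n → d ∣ X^m-1 n *ₚ B) gcd≡ (∣X^m-1*-gcd B m (r * k) (∣p⇒∣p*q B d∣X^m-1) d∣[X^rk-1]B)
  d∣B+ΦB : d ∣ B +ₚ Φ r k *ₚ B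
  d∣B+ΦB = ∣-resp-≋ (∣-trans (∣X^m-1*-mono B (gcd[m,n]∣n m k) d∣[X^gcd-1]B) (*-monoˡ-∣ B (X^m-1∣Φ-odd+1 k t))) (begin
    (Φ r k +ₚ oneₚ) *ₚ B           ≈⟨ *-distribʳ (Φ r k) oneₚ B ⟩
    Φ r k *ₚ B +ₚ oneₚ *ₚ B        ≈⟨ +-congˡ (Φ r k *ₚ B) (*-identityˡ B) ⟩
    Φ r k *ₚ B +ₚ B                ≈⟨ +-comm (Φ r k *ₚ B) B ⟩
    B +ₚ Φ r k *ₚ B                ∎)
    where open ≋-Reasoning

cExponents : ℕ → List ℕ
cExponents m = 0 ∷ 1 ∷ (m ∸ 1) ∷ 2 ∷ (m ∸ 2) ∷ 3 ∷ (m ∸ 3) ∷ 7 ∷ (m ∸ 7) ∷ []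

sparse-++-pair : ∀ g es a b → sparse g (es ++ a ∷ b ∷ []) ≋ sparse g es +ₚ (X^ (a * g) +ₚ X^ (b * g))
sparse-++-pair g es a b =
  ≋-trans (sparse-++ g es (a ∷ b ∷ [])) (+-congˡ (sparse g es) (+-congˡ (X^ (a * g)) (+-identityʳ (X^ (b * g)))))

sparse-cExponents : ∀ m k → sparse k (cExponents m) ≋ cPoly m k
sparse-cExponents m k = begin
  sparse k (E₃ ++ pair 7)
    ≈⟨ sparse-++-pair k E₃ 7 (m ∸ 7) ⟩
  sparse k (E₂ ++ pair 3) +ₚ A 7
    ≈⟨ +-congʳ (A 7) (sparse-++-pair k E₂ 3 (m ∸ 3)) ⟩
  (sparse k (E₁ ++ pair 2) +ₚ A 3) +ₚ A 7
    ≈⟨ +-congʳ (A 7) (+-congʳ (A 3) (sparse-++-pair k E₁ 2 (m ∸ 2))) ⟩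
  ((sparse k (E₀ ++ pair 1) +ₚ A 2) +ₚ A 3) +ₚ A 7
    ≈⟨ +-congʳ (A 7) (+-congʳ (A 3) (+-congʳ (A 2) (sparse-++-pair k E₀ 1 (m ∸ 1)))) ⟩
  (((sparse k E₀ +ₚ A 1) +ₚ A 2) +ₚ A 3) +ₚ A 7
    ≈⟨ +-congʳ (A 7) (+-congʳ (A 3) (+-congʳ (A 2) (+-congʳ (A 1) (+-identityʳ oneₚ)))) ⟩
  cPoly m k
    ∎
  where
  open ≋-Reasoning
  pair : ℕ → List ℕ
  pair j = j ∷ (m ∸ j) ∷ []
  A : ℕ → Poly
  A j = X^ (j * k) +ₚ X^ ((m ∸ j) * k)
  E₀ E₁ E₂ E₃ : List ℕ
  E₀ = 0 ∷ []
  E₁ = E₀ ++ pair 1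
  E₂ = E₁ ++ pair 2
  E₃ = E₂ ++ pair 3

[n+[m∸j]]%m≡[n∸j]%m : ∀ {m} .{{_ : NonZero m}} {n j} → j ≤ n → j ≤ m → (n + (m ∸ j)) % m ≡ (n ∸ j) % m
[n+[m∸j]]%m≡[n∸j]%m {m} {n} {j} j≤n j≤m = begin
  (n + (m ∸ j)) % m     ≡⟨ cong (_% m) (ℕ.+-∸-assoc n j≤m) ⟨
  ((n + m) ∸ j) % m     ≡⟨ cong (_% m) (ℕ.+-∸-comm m j≤n) ⟩
  ((n ∸ j) + m) % m     ≡⟨ [m+n]%n≡m%n (n ∸ j) m ⟩
  (n ∸ j) % m           ∎
  where open ≡-Reasoning

-- The exponents 7 + e of x^7 c(x), reduced modulo m.
P-exponents : List ℕ
P-exponents = 7 ∷ 8 ∷ 6 ∷ 9 ∷ 5 ∷ 10 ∷ 4 ∷ 14 ∷ 0 ∷ []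

P-factorisation : normalise P-exponents ≡ normalise (upTo 3 ⊛ upTo 3 ⊛ upTo 5 ⊛ upTo 7 ⊛ (0 ∷ []))
P-factorisation = refl

X^m-1∣X^7k*cPoly+P : ∀ m k → 7 ≤ m → X^m-1 (m * k) ∣ X^ (7 * k) *ₚ cPoly m k +ₚ sparse k P-exponents
X^m-1∣X^7k*cPoly+P m k 7≤m =
  ∣-resp-≋ (X^m-1∣sparse+sparse m k residues) (+-congʳ (sparse k P-exponents) (≋-sym shifted))
  where
  shifted : X^ (7 * k) *ₚ cPoly m k ≋ sparse k (map (7 +_) (cExponents m))
  shifted = ≋-trans (*-congˡ (X^ (7 * k)) (≋-sym (sparse-cExponents m k))) (X^*sparse k 7 (cExponents m))
  instance _ = >-nonZero (ℕ.<-≤-trans z<s 7≤m)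
  wrap : ∀ j → j ≤ 7 → (7 + (m ∸ j)) % m ≡ (7 ∸ j) % m
  wrap j j≤7 = [n+[m∸j]]%m≡[n∸j]%m j≤7 (ℕ.≤-trans j≤7 7≤m)
  residues : Pointwise (_≡_ on (_% m)) (map (7 +_) (cExponents m)) P-exponents
  residues = refl ∷ refl ∷ wrap 1 (ℕ.m≤m+n 1 6) ∷ refl ∷ wrap 2 (ℕ.m≤m+n 2 5) ∷ refl ∷ wrap 3 (ℕ.m≤m+n 3 4)
           ∷ refl ∷ wrap 7 ℕ.≤-refl ∷ []

cPoly-coprime : ∀ m k → 7 ≤ m → gcd m (3 * k) ≡ gcd m k → gcd m (5 * k) ≡ gcd m k → gcd m (7 * k) ≡ gcd m k →
                ∀ {d} → d ∣ cPoly m k → d ∣ X^m-1 m → d ∣ oneₚ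
cPoly-coprime m k 7≤m g₃ g₅ g₇ {d} d∣c d∣X^m-1 =
  ∣-resp-≋ (∣Φ*-cancel m k 3 B₇ g₇ d∣X^m-1 (∣Φ*-cancel m k 2 B₅ g₅ d∣X^m-1
             (∣Φ*-cancel m k 1 B₃ g₃ d∣X^m-1 (∣Φ*-cancel m k 1 B₃′ g₃ d∣X^m-1 d∣ΦΦΦΦ)))) (+-identityʳ oneₚ)
  where
  open ≋-Reasoning
  B₇ = sparse k (0 ∷ [])
  B₅ = Φ 7 k *ₚ B₇
  B₃ = Φ 5 k *ₚ B₅
  B₃′ = Φ 3 k *ₚ B₃
  d∣P : d ∣ sparse k P-exponents
  d∣P = ∣-cancelˡ (∣-trans (∣-trans d∣X^m-1 (X^m-1-mono-∣ (ℕ∣.m∣m*n {m} k))) (X^m-1∣X^7k*cPoly+P m k 7≤m))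
                  (∣q⇒∣p*q (X^ (7 * k)) d∣c)
  d∣ΦΦΦΦ : d ∣ Φ 3 k *ₚ B₃′
  d∣ΦΦΦΦ = ∣-resp-≋ d∣P (begin
    sparse k P-exponents
      ≈⟨ sparse-≋ k P-exponents (upTo 3 ⊛ upTo 3 ⊛ Q₅) P-factorisation ⟩
    sparse k (upTo 3 ⊛ upTo 3 ⊛ Q₅)
      ≈⟨ sparse-⊛ k (upTo 3) (upTo 3 ⊛ Q₅) ⟨
    Φ 3 k *ₚ sparse k (upTo 3 ⊛ Q₅)
      ≈⟨ *-congˡ (Φ 3 k) (≋-sym (sparse-⊛ k (upTo 3) Q₅)) ⟩
    Φ 3 k *ₚ (Φ 3 k *ₚ sparse k (upTo 5 ⊛ Q₇))
      ≈⟨ *-congˡ (Φ 3 k) (*-congˡ (Φ 3 k) (≋-sym (sparse-⊛ k (upTo 5) Q₇))) ⟩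
    Φ 3 k *ₚ (Φ 3 k *ₚ (Φ 5 k *ₚ sparse k Q₇))
      ≈⟨ *-congˡ (Φ 3 k) (*-congˡ (Φ 3 k) (*-congˡ (Φ 5 k) (≋-sym (sparse-⊛ k (upTo 7) (0 ∷ []))))) ⟩
    Φ 3 k *ₚ B₃′
      ∎)
    where
    Q₇ = upTo 7 ⊛ (0 ∷ [])
    Q₅ = upTo 5 ⊛ Q₇

-- The gcd conditions from coprimality

prime-gcd-jump : ∀ {r} m k → Prime r → gcd m (r * k) ≢ gcd m k → r * gcd m k ∣ℕ m × ¬ (r * gcd m k ∣ℕ k)
prime-gcd-jump {r} m k r-prime g≢G = rG∣m , rG∤k
  where
  G = gcd m k
  g = gcd m (r * k)
  G∣g : G ∣ℕ g
  G∣g = gcd-greatest (gcd[m,n]∣m m k) (ℕ∣.∣n⇒∣m*n r (gcd[m,n]∣n m k))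
  open ℕ∣._∣_ G∣g renaming (quotient to t; equality to g≡tG)
  instance
    G≢0 : NonZero G
    G≢0 = ≢-nonZero λ G≡0 → g≢G (trans g≡tG (trans (cong (t *_) G≡0) (trans (ℕ.*-zeroʳ t) (sym G≡0))))
  g∣rG : g ∣ℕ r * G
  g∣rG = subst (g ∣ℕ_) (sym (c*gcd[m,n]≡gcd[cm,cn] r m k))
    (gcd-greatest (ℕ∣.∣n⇒∣m*n r (gcd[m,n]∣m m (r * k))) (gcd[m,n]∣n m (r * k)))
  t≡r : t ≡ r
  t≡r with prime⇒irreducible r-prime (ℕ∣.*-cancelʳ-∣ G (subst (_∣ℕ r * G) g≡tG g∣rG))
  ... | inj₁ t≡1 = ⊥-elim (g≢G (trans g≡tG (trans (cong (_* G) t≡1) (ℕ.*-identityˡ G))))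
  ... | inj₂ t≡r = t≡r
  rG∣m : r * G ∣ℕ m
  rG∣m = subst (_∣ℕ m) (trans g≡tG (cong (_* G) t≡r)) (gcd[m,n]∣m m (r * k))
  rG∤k : ¬ (r * G ∣ℕ k)
  rG∤k rG∣k = ¬prime[1] (subst Prime (ℕ∣.∣1⇒≡1 (ℕ∣.*-cancelʳ-∣ G (subst (r * G ∣ℕ_) (sym (ℕ.*-identityˡ G))
    (gcd-greatest rG∣m rG∣k)))) r-prime)

[m∸j]%r≡[n∸j]%r : ∀ {r} .{{_ : NonZero r}} {m n} j → r ∣ℕ m → r ∣ℕ n → j ≤ m → j ≤ n →
                  (m ∸ j) % r ≡ (n ∸ j) % r
[m∸j]%r≡[n∸j]%r {r} {m} {n} j r∣m r∣n j≤m j≤n = begin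
  (m ∸ j) % r         ≡⟨ %-remove-+ʳ (m ∸ j) r∣n ⟨
  ((m ∸ j) + n) % r   ≡⟨ cong (_% r) (ℕ.+-∸-comm n j≤m) ⟨
  ((m + n) ∸ j) % r   ≡⟨ cong (λ x → (x ∸ j) % r) (ℕ.+-comm m n) ⟩
  ((n + m) ∸ j) % r   ≡⟨ cong (_% r) (ℕ.+-∸-comm m j≤n) ⟩
  ((n ∸ j) + m) % r   ≡⟨ %-remove-+ʳ (n ∸ j) r∣m ⟩
  (n ∸ j) % r         ∎
  where open ≡-Reasoning

%-*-cong : ∀ {r} .{{_ : NonZero r}} {e f} k → e % r ≡ f % r → (e * k) % r ≡ (f * (k % r) % r) % r
%-*-cong {r} {e} {f} k e≡f = begin
  (e * k) % r                   ≡⟨ %-distribˡ-* e k r ⟩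
  (e % r * (k % r)) % r         ≡⟨ cong₂ (λ x y → (x * y) % r) e≡f (sym (m%n%n≡m%n k r)) ⟩
  (f % r * (k % r % r)) % r     ≡⟨ %-distribˡ-* f (k % r) r ⟨
  (f * (k % r)) % r             ≡⟨ m%n%n≡m%n (f * (k % r)) r ⟨
  (f * (k % r) % r) % r         ∎
  where open ≡-Reasoning

-- The exponents of c(x^s) reduced mod r; any multiple n ≥ 7 of r stands in for m, as only r ∣ m matters.
cResidues : ∀ r .{{_ : NonZero r}} → ℕ → ℕ → List ℕ
cResidues r n s = map (λ e → e * s % r) (cExponents n)

map-*-residues : ∀ {r} .{{_ : NonZero r}} {es fs} k → Pointwise (_≡_ on (_% r)) es fs →
                 Pointwise (_≡_ on (_% r)) (map (_* k) es) (map (λ f → f * (k % r) % r) fs)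
map-*-residues k []          = []
map-*-residues k (e≡f ∷ pw) = %-*-cong k e≡f ∷ map-*-residues k pw

cExponents-cong : ∀ {r} .{{_ : NonZero r}} {m n} → r ∣ℕ m → r ∣ℕ n → 7 ≤ m → 7 ≤ n →
                  Pointwise (_≡_ on (_% r)) (cExponents m) (cExponents n)
cExponents-cong {r} {m} {n} r∣m r∣n 7≤m 7≤n =
  refl ∷ refl ∷ wrap 1 (ℕ.m≤m+n 1 6) ∷ refl ∷ wrap 2 (ℕ.m≤m+n 2 5) ∷ refl ∷ wrap 3 (ℕ.m≤m+n 3 4)
  ∷ refl ∷ wrap 7 ℕ.≤-refl ∷ []
  where
  wrap : ∀ j → j ≤ 7 → (m ∸ j) % r ≡ (n ∸ j) % r
  wrap j j≤7 = [m∸j]%r≡[n∸j]%r j r∣m r∣n (ℕ.≤-trans j≤7 7≤m) (ℕ.≤-trans j≤7 7≤n)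

ResiduesCyclotomic : ∀ r .{{_ : NonZero r}} → ℕ → Set
ResiduesCyclotomic r n = ∀ s → 0 < s → s < r →
  normalise (cResidues r n s) ≡ [] ⊎ normalise (cResidues r n s) ≡ normalise (upTo r)

Φ∣X^m-1 : ∀ r g → Φ r g ∣ X^m-1 (r * g)
Φ∣X^m-1 r g = divides (X^m-1 g) (≋-trans (*-comm (Φ r g) (X^m-1 g)) (X^m-1*Φ g r))

Φ∣cPoly : ∀ t n → let r = 2 + t in r ∣ℕ n → 7 ≤ n → ResiduesCyclotomic r n →
          ∀ {m k g} .{{_ : NonZero g}} → 7 ≤ m → r * g ∣ℕ m → g ∣ℕ k → ¬ (r * g ∣ℕ k) → Φ r g ∣ cPoly m k
Φ∣cPoly t n r∣n 7≤n residues {m} {g = g} 7≤m rg∣m (dividesℕ k′ refl) rg∤k =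
  ∣-resp-≋ (∣-cancelʳ (∣-trans (Φ∣X^m-1 r g) reduction) Φ∣residues) (≋-sym cPoly≋)
  where
  r = 2 + t
  s = k′ % r
  E = map (_* k′) (cExponents m)
  cPoly≋ : cPoly m (k′ * g) ≋ sparse g E
  cPoly≋ = ≋-trans (≋-sym (sparse-cExponents m (k′ * g))) (sparse-scale k′ g (cExponents m))
  reduction : X^m-1 (r * g) ∣ sparse g E +ₚ sparse g (cResidues r n s)
  reduction = X^m-1∣sparse+sparse r g
    (map-*-residues k′ (cExponents-cong (ℕ∣.∣-trans (ℕ∣.m∣m*n g) rg∣m) r∣n 7≤m 7≤n))
  0<s : 0 < s
  0<s = ℕ.n≢0⇒n>0 λ s≡0 → rg∤k (ℕ∣.*-monoˡ-∣ g (m%n≡0⇒n∣m k′ r s≡0))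
  Φ∣residues : Φ r g ∣ sparse g (cResidues r n s)
  Φ∣residues with residues s 0<s (m%n<n k′ r)
  ... | inj₁ ≡[] = ∣-zero (sparse-≋ g (cResidues r n s) [] ≡[])
  ... | inj₂ ≡Φ  = ∣-resp-≋ ∣-refl (sparse-≋ g (upTo r) (cResidues r n s) (sym ≡Φ))

gcd-preserved : ∀ t n → let r = 2 + t in Prime r → r ∣ℕ n → 7 ≤ n → ResiduesCyclotomic r n →
                ∀ m k → 7 ≤ m → GcdOne (cPoly m k) (X^m-1 m) → gcd m (r * k) ≡ gcd m k
gcd-preserved t n r-prime r∣n 7≤n residues m k 7≤m coprime with gcd m ((2 + t) * k) ℕ.≟ gcd m k
... | yes g≡G = g≡G
... | no  g≢G = ⊥-elim (Φ-¬∣1 G t (∣ₚ⇒∣ (coprime (Φ r G) (∣⇒∣ₚ Φ∣c) (∣⇒∣ₚ Φ∣X^m))))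
  where
  r = 2 + t
  G = gcd m k
  instance
    _ = ≢-nonZero (gcd[m,n]≢0 m k (inj₁ (≢-nonZero⁻¹ m {{>-nonZero (ℕ.<-≤-trans z<s 7≤m)}})))
  rG∣m,rG∤k : r * G ∣ℕ m × ¬ (r * G ∣ℕ k)
  rG∣m,rG∤k = prime-gcd-jump m k r-prime g≢G
  rG∣m = proj₁ rG∣m,rG∤k
  Φ∣c : Φ r G ∣ cPoly m k
  Φ∣c = Φ∣cPoly t n r∣n 7≤n residues 7≤m rG∣m (gcd[m,n]∣n m k) (proj₂ rG∣m,rG∤k)
  Φ∣X^m : Φ r G ∣ X^m-1 m
  Φ∣X^m = ∣-trans (Φ∣X^m-1 r G) (X^m-1-mono-∣ rG∣m)

residues-3 : ResiduesCyclotomic 3 9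
residues-3 1 _ _ = inj₂ refl
residues-3 2 _ _ = inj₂ refl
residues-3 (suc (suc (suc _))) _ (s<s (s<s (s<s ())))

residues-5 : ResiduesCyclotomic 5 10
residues-5 1 _ _ = inj₂ refl
residues-5 2 _ _ = inj₂ refl
residues-5 3 _ _ = inj₂ refl
residues-5 4 _ _ = inj₂ refl
residues-5 (suc (suc (suc (suc (suc _))))) _ (s<s (s<s (s<s (s<s (s<s ())))))

residues-7 : ResiduesCyclotomic 7 7
residues-7 1 _ _ = inj₂ refl
residues-7 2 _ _ = inj₂ refl
residues-7 3 _ _ = inj₂ refl
residues-7 4 _ _ = inj₂ refl
residues-7 5 _ _ = inj₂ refl
residues-7 6 _ _ = inj₂ refl
residues-7 (suc (suc (suc (suc (suc (suc (suc _))))))) _ (s<s (s<s (s<s (s<s (s<s (s<s (s<s ())))))))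

proposition7 : (m k : ℕ) → 15 ≤ m → 1 ≤ k →
    GcdOne (cPoly m k) (X^m-1 m) ⇔
    ((gcd m (3 * k) ≡ gcd m k) × (gcd m (5 * k) ≡ gcd m k) × (gcd m (7 * k) ≡ gcd m k))
proposition7 m k 15≤m _ = mk⇔
  (λ coprime → gcd-preserved 1 9  (from-yes (prime? 3)) (dividesℕ 3 refl) (ℕ.m≤m+n 7 2) residues-3 m k 7≤m coprime
             , gcd-preserved 3 10 (from-yes (prime? 5)) (dividesℕ 2 refl) (ℕ.m≤m+n 7 3) residues-5 m k 7≤m coprime
             , gcd-preserved 5 7  (from-yes (prime? 7)) ℕ∣.∣-refl         ℕ.≤-refl        residues-7 m k 7≤m coprime)
  (λ (g₃ , g₅ , g₇) d d∣c d∣X^m →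
     ∣⇒∣ₚ (cPoly-coprime m k 7≤m g₃ g₅ g₇ (∣ₚ⇒∣ {d} d∣c) (∣ₚ⇒∣ {d} d∣X^m)))
  where
  7≤m : 7 ≤ m
  7≤m = ℕ.≤-trans (ℕ.m≤m+n 7 8) 15≤m
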